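{- Let $G$ be an infinitely edge-connected graph, and let $\{A,B\}$ and $\{C,D\}$ be unitary compound-separations of $G$ with distinct separators $u$ and $v$, respectively, such that $u\in C$ and $v\in B$. Then $(A,B)\le(C,D)$; in particular, $\{A,B\}$ and $\{C,D\}$ are nested.
   Context: All graphs are simple. A graph (with at least two vertices) is infinitely edge-connected if no two vertices are separated by deleting finitely many edges. A compound-separation of an infinite graph $G$ is a pair $\{A,B\}$ with $A\cup B=V(G)$, $A\setminus B,B\setminus A\ne\emptyset$, $A\cap B$ finite and only finitely many edges between $A\setminus B$ and $B\setminus A$; it is unitary with separator $w$ if $A\cap B=\{w\}$. For oriented separations, $(A,B)\le(C,D)$ iff $A\subseteq C$ and $B\supseteq D$; two separations are nested if they have comparable orientations. -}

module Defs where

open import Level using (0ℓ)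
open import Data.Product using (Σ; ∃; _×_; _,_)
open import Data.Sum using (_⊎_)
open import Data.Empty using (⊥)
open import Data.List using (List)
open import Data.List.Membership.Propositional using (_∈_)
open import Relation.Nullary using (¬_)
open import Relation.Binary.PropositionalEquality using (_≡_)

record Graph : Set₁ where
  field
    V     : Set
    E     : V → V → Set
    sym   : ∀ {x y} → E x y → E y x
    irrefl : ∀ {x} → ¬ E x x

Subset : Set → Set₁
Subset X = X → Set

FiniteSubset : {X : Set} → Subset X → Set
FiniteSubset {X} P = Σ (List X) λ L → ∀ x → P x → x ∈ L

module _ (G : Graph) where
  open Graph G

  Infinite : Set
  Infinite = ¬ (Σ (List V) λ L → ∀ x → x ∈ L)

  -- A finite set of edges, given as a list of ordered pairs; an edge {a,b}
  -- is deleted if (a,b) or (b,a) occurs in the list.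
  Deleted : List (V × V) → V → V → Set
  Deleted F a b = ((a , b) ∈ F) ⊎ ((b , a) ∈ F)

  data WalkAvoiding (F : List (V × V)) : V → V → Set where
    [] : ∀ {x} → WalkAvoiding F x x
    step : ∀ {x z y} → E x z → ¬ Deleted F x z → WalkAvoiding F z y →
           WalkAvoiding F x y

  SeparatedBy : List (V × V) → V → V → Set
  SeparatedBy F x y = ¬ WalkAvoiding F x y

  InfinitelyEdgeConnected : Set
  InfinitelyEdgeConnected =
    (Σ V λ x → Σ V λ y → ¬ x ≡ y) ×
    (∀ (F : List (V × V)) (x y : V) → ¬ SeparatedBy F x y)

  FinitelyManyEdgesBetween : Subset V → Subset V → Set
  FinitelyManyEdgesBetween X Y =
    Σ (List (V × V)) λ L → ∀ x y → X x → Y y → E x y → (x , y) ∈ L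

  _∖_ : Subset V → Subset V → Subset V
  (A ∖ B) x = A x × ¬ B x

  record IsCompoundSeparation (A B : Subset V) : Set where
    field
      cover        : ∀ x → A x ⊎ B x
      A∖B-nonempty : ∃ λ x → (A ∖ B) x
      B∖A-nonempty : ∃ λ x → (B ∖ A) x
      finite-cap   : FiniteSubset (λ x → A x × B x)
      finite-edges : FinitelyManyEdgesBetween (A ∖ B) (B ∖ A)

  IsUnitaryWith : (A B : Subset V) → V → Set
  IsUnitaryWith A B w =
    IsCompoundSeparation A B × (∀ x → (A x × B x → x ≡ w) × (x ≡ w → A x × B x))

  _≤ˢ_ : (Subset V × Subset V) → (Subset V × Subset V) → Set
  (A , B) ≤ˢ (C , D) = (∀ x → A x → C x) × (∀ x → D x → B x)

  Nested : (A B C D : Subset V) → Set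
  Nested A B C D =
    ((A , B) ≤ˢ (C , D) ⊎ (C , D) ≤ˢ (A , B)) ⊎
    ((A , B) ≤ˢ (D , C) ⊎ (D , C) ≤ˢ (A , B)) ⊎
    ((B , A) ≤ˢ (C , D) ⊎ (C , D) ≤ˢ (B , A)) ⊎
    ((B , A) ≤ˢ (D , C) ⊎ (D , C) ≤ˢ (B , A))

-- Let F be the finitely many edges crossing {A,B} or {C,D}. The corner
-- (A∖B) ∩ (D∖C) is closed under edges outside F: an edge leaving it into B
-- must end at the separator u (every other such edge lies in F), but u ∈ C,
-- so the edge also leaves D∖C towards C and must end at v ≠ u; symmetrically
-- for C. As v ∈ B lies outside the corner and G stays connected after
-- deleting F, the corner is empty, which gives A ⊆ C and, by the symmetric
-- argument, D ⊆ B.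
module Submission where

open import Defs
open import Level using (0ℓ)
open import Axiom.ExcludedMiddle using (ExcludedMiddle)
open import Data.Product using (_×_; _,_; proj₁; proj₂)
open import Data.Product using () renaming (swap to ×-swap)
open import Data.Sum using (_⊎_; inj₁; inj₂)
open import Data.Sum using () renaming (swap to ⊎-swap)
open import Data.Empty using (⊥; ⊥-elim)
open import Data.List using (List; _++_)
open import Data.List.Relation.Binary.Subset.Propositional using (_⊆_)
open import Data.List.Membership.Propositional.Properties using (∈-++⁺ˡ; ∈-++⁺ʳ)
open import Function using (_∘_)
open import Relation.Nullary using (¬_; yes; no)
open import Relation.Binary.PropositionalEquality using (_≡_; refl; sym)

module _ (G : Graph) where
  open Graph G renaming (sym to E-sym)

  ClosedAvoiding : List (V × V) → Subset V → Set
  ClosedAvoiding F S = ∀ {z z'} → S z → E z z' → ¬ Deleted G F z z' → S z'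

  closed-along-walk : ∀ {F S x y} → ClosedAvoiding F S → S x → WalkAvoiding G F x y → S y
  closed-along-walk closed Sx []               = Sx
  closed-along-walk closed Sx (step e nd walk) = closed-along-walk closed (closed Sx e nd) walk

  closed-not-separating : ∀ {F S x y} → InfinitelyEdgeConnected G →
    ClosedAvoiding F S → S x → ¬ S y → ⊥
  closed-not-separating (_ , connected) closed Sx ¬Sy =
    connected _ _ _ (¬Sy ∘ closed-along-walk closed Sx)

  Cuts : List (V × V) → Subset V → Subset V → Set
  Cuts F A B = ∀ {x y} → (_∖_ G A B) x → (_∖_ G B A) y → E x y → Deleted G F x y

  Cuts-sym : ∀ {F A B} → Cuts F A B → Cuts F B A
  Cuts-sym cut x∈B∖A y∈A∖B e = ⊎-swap (cut y∈A∖B x∈B∖A (E-sym e))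

  crossingEdges : ∀ {A B} → IsCompoundSeparation G A B → List (V × V)
  crossingEdges = proj₁ ∘ IsCompoundSeparation.finite-edges

  crossingEdges-cut : ∀ {F A B} (sep : IsCompoundSeparation G A B) →
    crossingEdges sep ⊆ F → Cuts F A B
  crossingEdges-cut sep ⊆F x∈A∖B y∈B∖A e =
    inj₁ (⊆F (proj₂ (IsCompoundSeparation.finite-edges sep) _ _ x∈A∖B y∈B∖A e))

  record UnitaryCut (F : List (V × V)) (A B : Subset V) (u : V) : Set where
    field
      cover : ∀ x → A x ⊎ B x
      cap   : ∀ {x} → A x → B x → x ≡ u
      cut   : Cuts F A B

  UnitaryCut-swap : ∀ {F A B u} → UnitaryCut F A B u → UnitaryCut F B A u
  UnitaryCut-swap c = record
    { cover = ⊎-swap ∘ cover ; cap = λ Bx Ax → cap Ax Bx ; cut = Cuts-sym cut }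
    where open UnitaryCut c

  UnitaryCut-outside-B : ∀ {F A B u x} → UnitaryCut F A B u → ¬ B x → A x
  UnitaryCut-outside-B {x = x} c ¬Bx with UnitaryCut.cover c x
  ... | inj₁ Ax = Ax
  ... | inj₂ Bx = ⊥-elim (¬Bx Bx)

  unitaryCut : ∀ {F A B u} (sep : IsUnitaryWith G A B u) →
    crossingEdges (proj₁ sep) ⊆ F → UnitaryCut F A B u
  unitaryCut (sep , cap) ⊆F = record
    { cover = IsCompoundSeparation.cover sep
    ; cap   = λ Ax Bx → proj₁ (cap _) (Ax , Bx)
    ; cut   = crossingEdges-cut sep ⊆F
    }

  Corner : Subset V → Subset V → Subset V → Subset V → Subset V
  Corner A B C D z = (_∖_ G A B) z × (_∖_ G D C) z

  module _ (em : ExcludedMiddle 0ℓ) {F : List (V × V)} where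

    exit-through-separator : ∀ {A B u z z'} → UnitaryCut F A B u →
      (_∖_ G A B) z → B z' → E z z' → ¬ Deleted G F z z' → z' ≡ u
    exit-through-separator {A} {z' = z'} c z∈A∖B Bz' e nd with em {A z'}
    ... | yes Az' = UnitaryCut.cap c Az' Bz'
    ... | no ¬Az' = ⊥-elim (nd (UnitaryCut.cut c z∈A∖B (Bz' , ¬Az') e))

    corner-avoids : ∀ {A B C D u v z z'} → UnitaryCut F A B u → UnitaryCut F C D v →
      ¬ u ≡ v → C u → Corner A B C D z → E z z' → ¬ Deleted G F z z' → ¬ B z'
    corner-avoids cAB cCD u≢v Cu (z∈A∖B , z∈D∖C) e nd Bz'
      with exit-through-separator cAB z∈A∖B Bz' e nd
    ... | refl = u≢v (exit-through-separator (UnitaryCut-swap cCD) z∈D∖C Cu e nd)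

    corner-closed : ∀ {A B C D u v} → UnitaryCut F A B u → UnitaryCut F C D v →
      ¬ u ≡ v → C u → B v → ClosedAvoiding F (Corner A B C D)
    corner-closed {B = B} {C} cAB cCD u≢v Cu Bv {z' = z'} z∈corner e nd =
      (UnitaryCut-outside-B cAB ¬Bz' , ¬Bz') , (UnitaryCut-outside-B (UnitaryCut-swap cCD) ¬Cz' , ¬Cz')
      where
      ¬Bz' : ¬ B z'
      ¬Bz' = corner-avoids cAB cCD u≢v Cu z∈corner e nd
      ¬Cz' : ¬ C z'
      ¬Cz' = corner-avoids (UnitaryCut-swap cCD) (UnitaryCut-swap cAB) (u≢v ∘ sym) Bv
               (×-swap z∈corner) e nd

    corner-empty : ∀ {A B C D u v} → InfinitelyEdgeConnected G →
      UnitaryCut F A B u → UnitaryCut F C D v → ¬ u ≡ v → C u → B v →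
      ∀ x → ¬ Corner A B C D x
    corner-empty iec cAB cCD u≢v Cu Bv x x∈corner =
      closed-not-separating iec (corner-closed cAB cCD u≢v Cu Bv) x∈corner
        (λ ((_ , ¬Bv) , _) → ¬Bv Bv)

    empty-corner-⊆ : ∀ {A B C D u v} → UnitaryCut F A B u → UnitaryCut F C D v →
      C u → (∀ x → ¬ Corner A B C D x) → ∀ x → A x → C x
    empty-corner-⊆ {B = B} {C} cAB cCD Cu empty x Ax with em {C x}
    ... | yes Cx = Cx
    ... | no ¬Cx = ⊥-elim (empty x ((Ax , ¬Bx) , (UnitaryCut-outside-B (UnitaryCut-swap cCD) ¬Cx , ¬Cx)))
      where
      ¬Bx : ¬ B x
      ¬Bx Bx with UnitaryCut.cap cAB Ax Bx
      ... | refl = ¬Cx Cu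

lemma4p6 : ExcludedMiddle 0ℓ → (G : Graph) → Infinite G → InfinitelyEdgeConnected G →
    (A B C D : Subset (Graph.V G)) (u v : Graph.V G) →
    IsUnitaryWith G A B u → IsUnitaryWith G C D v → ¬ u ≡ v → C u → B v →
    _≤ˢ_ G (A , B) (C , D) × Nested G A B C D
lemma4p6 em G _ iec A B C D u v sAB sCD u≢v Cu Bv = AB≤CD , inj₁ (inj₁ AB≤CD)
  where
  F : List (Graph.V G × Graph.V G)
  F = crossingEdges G (proj₁ sAB) ++ crossingEdges G (proj₁ sCD)
  cAB : UnitaryCut G F A B u
  cAB = unitaryCut G sAB ∈-++⁺ˡ
  cCD : UnitaryCut G F C D v
  cCD = unitaryCut G sCD (∈-++⁺ʳ _)
  empty : ∀ x → ¬ Corner G A B C D x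
  empty = corner-empty G em iec cAB cCD u≢v Cu Bv
  AB≤CD : _≤ˢ_ G (A , B) (C , D)
  AB≤CD = empty-corner-⊆ G em cAB cCD Cu empty
        , empty-corner-⊆ G em (UnitaryCut-swap G cCD) (UnitaryCut-swap G cAB) Bv (λ x → empty x ∘ ×-swap)
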